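{- There exists a deterministic algorithm for the asymmetric streaming pattern matching problem that solves the problem using memory $O(1)$ and running time $O(nm)$, where $n=|T|$ is the length of the text and $m=|P|$ is the length of the pattern.
   Context: Asymmetric streaming pattern matching: a text $T$ over a finite alphabet $\Sigma$ is available via value queries (given an index $i$, an oracle returns the $i$-th character $T[i]$ in constant time), while a pattern $P$ over $\Sigma$ arrives as a stream of characters, read in order. The goal is to decide whether $P$ appears as a (contiguous) substring of $T$. Memory is measured in machine words, each able to hold an index into the strings or an integer of magnitude polynomial in $n$; the stored strings/oracle are not counted. -}

module Defs where

open import Data.Nat using (ℕ; zero; suc; _+_; _*_; _∸_; _^_; _≤_; _<?_; _≟_)
open import Data.Fin using (Fin; toℕ; fromℕ<)
open import Data.Vec using (Vec; lookup; _[_]≔_; replicate; _∷_; toList)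
open import Data.Vec.Relation.Unary.All using (All)
open import Data.List using (List; []; _∷_; _++_; length)
open import Data.Maybe using (Maybe; just; nothing)
open import Data.Bool using (Bool; true)
open import Data.Product using (Σ; ∃; _×_; _,_)
open import Relation.Nullary using (yes; no)
open import Relation.Binary.PropositionalEquality using (_≡_)
open import Function.Bundles using (_⇔_)

Occurs : ∀ {A : Set} → List A → List A → Set
Occurs P T = ∃ λ u → ∃ λ v → T ≡ u ++ P ++ v

-- A deterministic word-RAM-style machine with k registers (words),
-- L program lines, value-query access to the text T (length n, over the
-- alphabet Fin σ) and one-pass streaming access to the pattern P.
-- Characters are stored in words as their index toℕ.

data Instr (k L : ℕ) : Set where
  set   : Fin k → ℕ → Fin L → Instr k L
  add   : Fin k → Fin k → Fin k → Fin L → Instr k L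
  sub   : Fin k → Fin k → Fin k → Fin L → Instr k L
  mul   : Fin k → Fin k → Fin k → Fin L → Instr k L
  jeq   : Fin k → Fin k → Fin L → Fin L → Instr k L
  jlt   : Fin k → Fin k → Fin L → Fin L → Instr k L
  query : Fin k → Fin k → Fin L → Fin L → Instr k L
    -- if a < n then r := T[a], goto l₁ else goto l₂
  read  : Fin k → Fin L → Fin L → Instr k L
    -- if the stream is not exhausted, r := next pattern char, goto l₁;
    -- else goto l₂
  halt  : Bool → Instr k L

-- A program; execution starts at line zero (so L = suc L').
Program : ℕ → ℕ → Set
Program k L = Vec (Instr k (suc L)) (suc L)

record Conf (σ k L : ℕ) : Set where
  constructor conf
  field
    pc   : Fin (suc L)
    regs : Vec ℕ k
    rest : List (Fin σ)          -- the not yet read suffix of the pattern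

module _ {σ k L n : ℕ} (prog : Program k L) (T : Vec (Fin σ) n) where

  step : Conf σ k L → Maybe (Conf σ k L)
  step (conf pc R s) with lookup prog pc
  ... | set r v l = just (conf l (R [ r ]≔ v) s)
  ... | add r a b l = just (conf l (R [ r ]≔ (lookup R a + lookup R b)) s)
  ... | sub r a b l = just (conf l (R [ r ]≔ (lookup R a ∸ lookup R b)) s)
  ... | mul r a b l = just (conf l (R [ r ]≔ (lookup R a * lookup R b)) s)
  ... | jeq a b l₁ l₂ with lookup R a ≟ lookup R b
  ...   | yes _ = just (conf l₁ R s)
  ...   | no  _ = just (conf l₂ R s)
  step (conf pc R s) | jlt a b l₁ l₂ with lookup R a <? lookup R b
  ...   | yes _ = just (conf l₁ R s)
  ...   | no  _ = just (conf l₂ R s)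
  step (conf pc R s) | query r a l₁ l₂ with lookup R a <? n
  ...   | yes p = just (conf l₁ (R [ r ]≔ toℕ (lookup T (fromℕ< p))) s)
  ...   | no  _ = just (conf l₂ R s)
  step (conf pc R []) | read r l₁ l₂ = just (conf l₂ R [])
  step (conf pc R (x ∷ s)) | read r l₁ l₂ = just (conf l₁ (R [ r ]≔ toℕ x) s)
  step (conf pc R s) | halt _ = nothing

  -- Exec B c t b : started in configuration c, the machine halts with
  -- answer b after at most t steps, and every register value in every
  -- configuration visited is at most B (word-size bound).
  data Exec (B : ℕ) : Conf σ k L → ℕ → Bool → Set where
    done : ∀ {c t b} → All (_≤ B) (Conf.regs c) →
           lookup prog (Conf.pc c) ≡ halt b → Exec B c t b
    next : ∀ {c c′ t b} → All (_≤ B) (Conf.regs c) →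
           step c ≡ just c′ → Exec B c′ t b → Exec B c (suc t) b

initRegs : (k n : ℕ) → Vec ℕ k
initRegs zero    n = Data.Vec.[]
initRegs (suc k) n = n ∷ replicate k 0

init : ∀ {σ L} (k n : ℕ) → List (Fin σ) → Conf σ k L
init k n P = conf Data.Fin.zero (initRegs k n) P

-- "prog solves asymmetric streaming pattern matching with k = O(1) words
-- of memory, words of magnitude ≤ c·(n+1)^c, and time ≤ c·(n+1)(m+1)".
SolvesInTime : ∀ {σ k L} → Program k L → ℕ → Set
SolvesInTime {σ} {k} prog c =
  ∀ (n : ℕ) (T : Vec (Fin σ) n) (P : List (Fin σ)) →
    Σ Bool λ b →
      Exec prog T (c * suc n ^ c) (init k n P) (c * (suc n * suc (length P))) b
      × (b ≡ true ⇔ Occurs P (toList T))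

-- The program keeps O(1) words: the length J of the pattern prefix read so far and the position I
-- of its leftmost occurrence in T. When the next character x arrives, the leftmost occurrence of
-- the prefix extended by x is found by testing the candidates P′ = I, I + 1, ... in turn: P′ is
-- accepted when T[P′ + J] = x and T[P′ .. P′ + J) agrees with T[I .. I + J), the latter being
-- an occurrence of the old prefix. If no candidate fits inside T, the pattern does not occur.
-- Since I never decreases, at most n candidates are ever rejected, each after at most O(J) = O(m)
-- steps, and each of the m accepted characters costs O(J) = O(n) steps: O(nm) steps in all.
module Submission where

open import Defs
open import Data.Bool using (Bool; true; false)
open import Data.Empty using (⊥-elim)
open import Data.Fin using (Fin; toℕ; fromℕ<; #_)
import Data.Fin as Fin
open import Data.Fin.Properties using (toℕ<n; toℕ-injective)
open import Data.List using (List; []; _∷_; _++_; _∷ʳ_; [_]; length; take; drop)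
open import Data.List.Properties using (length-++; ∷ʳ-++; take++drop≡id; ++-identityʳ)
open import Data.Maybe using (Maybe; just; nothing)
open import Data.Maybe.Properties using (just-injective)
open import Data.Nat using (ℕ; zero; suc; _+_; _*_; _^_; _≤_; _<_; z≤n; s≤s; z<s; _<?_; _≟_)
open import Data.Nat.Properties
open import Algebra.Properties.CommutativeSemigroup +-commutativeSemigroup using (x∙yz≈y∙xz)
open import Data.Nat.Tactic.RingSolver using (solve-∀)
open import Data.Product using (Σ; ∃; _×_; _,_; proj₂)
open import Data.Sum using (inj₁; inj₂)
open import Data.Vec using (Vec; lookup; _[_]≔_; toList; []; _∷_)
open import Data.Vec.Properties using (length-toList)
open import Data.Vec.Relation.Unary.All as All using (All; []; _∷_)
open import Function using (_∘_)
open import Function.Bundles using (_⇔_; mk⇔)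
open import Relation.Nullary using (¬_; Dec; yes; no)
open import Relation.Binary.PropositionalEquality using (_≡_; _≢_; refl; sym; trans; cong; subst)

module _ {A : Set} where

  lookup? : List A → ℕ → Maybe A
  lookup? []       _       = nothing
  lookup? (x ∷ xs) zero    = just x
  lookup? (x ∷ xs) (suc i) = lookup? xs i

  length-∷ʳ : ∀ xs (x : A) → length (xs ∷ʳ x) ≡ suc (length xs)
  length-∷ʳ []       x = refl
  length-∷ʳ (y ∷ xs) x = cong suc (length-∷ʳ xs x)

  lookup?-++ˡ : ∀ xs (ys : List A) {i} → i < length xs → lookup? (xs ++ ys) i ≡ lookup? xs i
  lookup?-++ˡ (x ∷ xs) ys {zero}  _         = refl
  lookup?-++ˡ (x ∷ xs) ys {suc i} (s≤s i<n) = lookup?-++ˡ xs ys i<n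

  lookup?-++ʳ : ∀ xs (ys : List A) i → lookup? (xs ++ ys) (length xs + i) ≡ lookup? ys i
  lookup?-++ʳ []       ys i = refl
  lookup?-++ʳ (x ∷ xs) ys i = lookup?-++ʳ xs ys i

  lookup?-∷ʳ : ∀ xs (x : A) → lookup? (xs ∷ʳ x) (length xs) ≡ just x
  lookup?-∷ʳ []       x = refl
  lookup?-∷ʳ (y ∷ xs) x = lookup?-∷ʳ xs x

  lookup?-drop : ∀ i (xs : List A) j → lookup? (drop i xs) j ≡ lookup? xs (i + j)
  lookup?-drop zero    xs       j = refl
  lookup?-drop (suc i) []       j = refl
  lookup?-drop (suc i) (x ∷ xs) j = lookup?-drop i xs j

  lookup?≡just⇒< : ∀ xs {i} {x : A} → lookup? xs i ≡ just x → i < length xs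
  lookup?≡just⇒< (y ∷ xs) {zero}  _  = z<s
  lookup?≡just⇒< (y ∷ xs) {suc i} eq = s≤s (lookup?≡just⇒< xs eq)

  <⇒lookup?≡just : ∀ xs {i} → i < length xs → ∃ λ (x : A) → lookup? xs i ≡ just x
  <⇒lookup?≡just (x ∷ xs) {zero}  _         = x , refl
  <⇒lookup?≡just (x ∷ xs) {suc i} (s≤s i<n) = <⇒lookup?≡just xs i<n

  lookup?-agree⇒prefix : ∀ xs (ys : List A) → (∀ i → i < length xs → lookup? ys i ≡ lookup? xs i) →
                         ∃ λ zs → ys ≡ xs ++ zs
  lookup?-agree⇒prefix []       ys       _     = ys , refl
  lookup?-agree⇒prefix (x ∷ xs) []       agree with agree 0 z<s
  ... | ()
  lookup?-agree⇒prefix (x ∷ xs) (y ∷ ys) agree with agree 0 z<s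
  ... | refl with lookup?-agree⇒prefix xs ys (λ i i< → agree (suc i) (s≤s i<))
  ...   | zs , eq = zs , cong (x ∷_) eq

  record OccursAt (w t : List A) (i : ℕ) : Set where
    constructor occursAt
    field agrees : ∀ j → j < length w → lookup? t (i + j) ≡ lookup? w j

  open OccursAt public

  OccursBefore : List A → List A → ℕ → Set
  OccursBefore w t i = ∃ λ j → j < i × OccursAt w t j

  occursAt⇒occurs : ∀ w t i → OccursAt w t i → Occurs w t
  occursAt⇒occurs w t i occ
    with lookup?-agree⇒prefix w (drop i t) (λ j j< → trans (lookup?-drop i t j) (agrees occ j j<))
  ... | v , eq = take i t , v , trans (sym (take++drop≡id i t)) (cong (take i t ++_) eq)

  occurs⇒occursAt : ∀ w t → Occurs w t → ∃ (OccursAt w t)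
  occurs⇒occursAt w t (u , v , refl) =
    length u , occursAt λ j j< → trans (lookup?-++ʳ u (w ++ v) j) (lookup?-++ˡ w v j<)

  occursAt-++⁻ˡ : ∀ w v {t i} → OccursAt (w ++ v) t i → OccursAt w t i
  occursAt-++⁻ˡ w v occ = occursAt λ j j< →
    trans (agrees occ j (<-≤-trans j< (≤-trans (m≤m+n _ _) (≤-reflexive (sym (length-++ w))))))
          (lookup?-++ˡ w v j<)

  occursAt-∷ʳ⁻ : ∀ w x {t i} → OccursAt (w ∷ʳ x) t i → lookup? t (i + length w) ≡ just x
  occursAt-∷ʳ⁻ w x occ =
    trans (agrees occ (length w) (lookup?≡just⇒< (w ∷ʳ x) (lookup?-∷ʳ w x))) (lookup?-∷ʳ w x)

  occursAt-∷ʳ : ∀ w x {t i} → OccursAt w t i → lookup? t (i + length w) ≡ just x → OccursAt (w ∷ʳ x) t i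
  occursAt-∷ʳ w x {t} {i} occ hit = occursAt agrees′
    where
    agrees′ : ∀ j → j < length (w ∷ʳ x) → lookup? t (i + j) ≡ lookup? (w ∷ʳ x) j
    agrees′ j j< with m<1+n⇒m<n∨m≡n (subst (j <_) (length-∷ʳ w x) j<)
    ... | inj₁ j<w  = trans (agrees occ j j<w) (sym (lookup?-++ˡ w [ x ] j<w))
    ... | inj₂ refl = trans hit (sym (lookup?-∷ʳ w x))

  ¬occursBefore-suc : ∀ {w t i} → ¬ OccursBefore w t i → ¬ OccursAt w t i → ¬ OccursBefore w t (suc i)
  ¬occursBefore-suc before at (j , j<1+i , occ) with m<1+n⇒m<n∨m≡n j<1+i
  ... | inj₁ j<i  = before (j , j<i , occ)
  ... | inj₂ refl = at occ

  ¬occursBefore-++ : ∀ w v {t i} → ¬ OccursBefore w t i → ¬ OccursBefore (w ++ v) t i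
  ¬occursBefore-++ w v before (j , j<i , occ) = before (j , j<i , occursAt-++⁻ˡ w v occ)

  -- An occurrence at j ≥ i would put x at position j + length w ≥ length t.
  ¬occurs-beyond : ∀ w x v {t i} → ¬ OccursBefore (w ∷ʳ x) t i → length t ≤ i + length w →
                   ¬ Occurs ((w ∷ʳ x) ++ v) t
  ¬occurs-beyond w x v {t} {i} before t≤ occ with occurs⇒occursAt _ t occ
  ... | j , at with j <? i
  ...   | yes j<i = before (j , j<i , occursAt-++⁻ˡ (w ∷ʳ x) v at)
  ...   | no  j≮i = <⇒≱ (lookup?≡just⇒< t (occursAt-∷ʳ⁻ w x (occursAt-++⁻ˡ (w ∷ʳ x) v at)))
                        (≤-trans t≤ (+-monoˡ-≤ (length w) (≮⇒≥ j≮i)))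

lookup?-toList : ∀ {A : Set} {n} (v : Vec A n) {i} (i<n : i < n) →
                 lookup? (toList v) i ≡ just (lookup v (fromℕ< i<n))
lookup?-toList (x ∷ v) {zero}  _         = refl
lookup?-toList (x ∷ v) {suc i} (s≤s i<n) = lookup?-toList v i<n

module _ {σ k L n} {prog : Program k L} {T : Vec (Fin σ) n} where

  Exec-mono-steps : ∀ {B c t t′ b} → t ≤ t′ → Exec prog T B c t b → Exec prog T B c t′ b
  Exec-mono-steps _         (done bnd halts)       = done bnd halts
  Exec-mono-steps (s≤s t≤t′) (next bnd steps exec) = next bnd steps (Exec-mono-steps t≤t′ exec)

  Exec-mono-bound : ∀ {B B′ c t b} → B ≤ B′ → Exec prog T B c t b → Exec prog T B′ c t b
  Exec-mono-bound B≤B′ (done bnd halts)      = done (All.map (λ v≤B → ≤-trans v≤B B≤B′) bnd) halts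
  Exec-mono-bound B≤B′ (next bnd steps exec) =
    next (All.map (λ v≤B → ≤-trans v≤B B≤B′) bnd) steps (Exec-mono-bound B≤B′ exec)

module Run {σ k L n} (prog : Program k L) (T : Vec (Fin σ) n) (B : ℕ) where

  infixr 5 _++ˢ_

  data Steps : Conf σ k L → ℕ → Conf σ k L → Set where
    []   : ∀ {c} → Steps c 0 c
    tick : ∀ {c c′ c″ t} → All (_≤ B) (Conf.regs c) → step prog T c ≡ just c′ → Steps c′ t c″ →
           Steps c (suc t) c″

  _++ˢ_ : ∀ {c c′ c″ t u} → Steps c t c′ → Steps c′ u c″ → Steps c (t + u) c″
  []                  ++ˢ run′ = run′
  tick bnd steps run ++ˢ run′ = tick bnd steps (run ++ˢ run′)

  Steps-Exec : ∀ {c c′ t u b} → Steps c t c′ → Exec prog T B c′ u b → Exec prog T B c (t + u) b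
  Steps-Exec []                  exec = exec
  Steps-Exec (tick bnd steps run) exec = next bnd steps (Steps-Exec run exec)

  module _ {pc : Fin (suc L)} {R : Vec ℕ k} {s : List (Fin σ)} {c″ : Conf σ k L} {t : ℕ} where

    tick-query-in : ∀ {r a l₁ l₂} → All (_≤ B) R → lookup prog pc ≡ query r a l₁ l₂ →
                    (inside : lookup R a < n) → Steps (conf l₁ (R [ r ]≔ toℕ (lookup T (fromℕ< inside))) s) t c″ →
                    Steps (conf pc R s) (suc t) c″
    tick-query-in {r} {a} {l₁} bnd instr inside = tick bnd steps
      where
      steps : step prog T (conf pc R s) ≡ just (conf l₁ (R [ r ]≔ toℕ (lookup T (fromℕ< inside))) s)
      steps rewrite instr with lookup R a <? n
      ... | yes _       = refl
      ... | no  outside = ⊥-elim (outside inside)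

    tick-query-out : ∀ {r a l₁ l₂} → All (_≤ B) R → lookup prog pc ≡ query r a l₁ l₂ →
                     ¬ lookup R a < n → Steps (conf l₂ R s) t c″ → Steps (conf pc R s) (suc t) c″
    tick-query-out {a = a} {l₂ = l₂} bnd instr outside = tick bnd steps
      where
      steps : step prog T (conf pc R s) ≡ just (conf l₂ R s)
      steps rewrite instr with lookup R a <? n
      ... | yes inside = ⊥-elim (outside inside)
      ... | no  _      = refl

    tick-jeq-yes : ∀ {a b l₁ l₂} → All (_≤ B) R → lookup prog pc ≡ jeq a b l₁ l₂ →
                   lookup R a ≡ lookup R b → Steps (conf l₁ R s) t c″ → Steps (conf pc R s) (suc t) c″
    tick-jeq-yes {a} {b} {l₁} bnd instr eq = tick bnd steps
      where
      steps : step prog T (conf pc R s) ≡ just (conf l₁ R s)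
      steps rewrite instr with lookup R a ≟ lookup R b
      ... | yes _  = refl
      ... | no neq = ⊥-elim (neq eq)

    tick-jeq-no : ∀ {a b l₁ l₂} → All (_≤ B) R → lookup prog pc ≡ jeq a b l₁ l₂ →
                  lookup R a ≢ lookup R b → Steps (conf l₂ R s) t c″ → Steps (conf pc R s) (suc t) c″
    tick-jeq-no {a} {b} {l₂ = l₂} bnd instr neq = tick bnd steps
      where
      steps : step prog T (conf pc R s) ≡ just (conf l₂ R s)
      steps rewrite instr with lookup R a ≟ lookup R b
      ... | yes eq = ⊥-elim (neq eq)
      ... | no _   = refl

    tick-jlt-yes : ∀ {a b l₁ l₂} → All (_≤ B) R → lookup prog pc ≡ jlt a b l₁ l₂ →
                   lookup R a < lookup R b → Steps (conf l₁ R s) t c″ → Steps (conf pc R s) (suc t) c″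
    tick-jlt-yes {a} {b} {l₁} bnd instr lt = tick bnd steps
      where
      steps : step prog T (conf pc R s) ≡ just (conf l₁ R s)
      steps rewrite instr with lookup R a <? lookup R b
      ... | yes _  = refl
      ... | no ≮   = ⊥-elim (≮ lt)

    tick-jlt-no : ∀ {a b l₁ l₂} → All (_≤ B) R → lookup prog pc ≡ jlt a b l₁ l₂ →
                  ¬ lookup R a < lookup R b → Steps (conf l₂ R s) t c″ → Steps (conf pc R s) (suc t) c″
    tick-jlt-no {a} {b} {l₂ = l₂} bnd instr ≮ = tick bnd steps
      where
      steps : step prog T (conf pc R s) ≡ just (conf l₂ R s)
      steps rewrite instr with lookup R a <? lookup R b
      ... | yes lt = ⊥-elim (≮ lt)
      ... | no _   = refl

-- Registers: 0 = n, 1 = 0, 2 = 1, 3 = I, 4 = J, 5 = x, 6 = P′, 7 = address of a text query,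
-- 8 and 9 = characters read from T, 10 = k.
program : Program 11 18
program =
  set (# 2) 1 (# 1) ∷                 --  0
  read (# 5) (# 2) (# 17) ∷           --  1  x ← next character of P; at the end of P, accept
  add (# 6) (# 1) (# 3) (# 3) ∷       --  2  P′ ← I
  add (# 7) (# 6) (# 4) (# 4) ∷       --  3
  query (# 8) (# 7) (# 5) (# 18) ∷    --  4  if P′ + J ≥ n, reject
  jeq (# 8) (# 5) (# 6) (# 14) ∷      --  5  if T[P′ + J] ≠ x, next candidate
  set (# 10) 0 (# 7) ∷                --  6  k ← 0
  jlt (# 10) (# 4) (# 8) (# 15) ∷     --  7  while k < J:
  add (# 7) (# 6) (# 10) (# 9) ∷      --  8
  query (# 8) (# 7) (# 10) (# 14) ∷   --  9    T[P′ + k], or next candidate if out of range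
  add (# 7) (# 3) (# 10) (# 11) ∷     -- 10
  query (# 9) (# 7) (# 12) (# 14) ∷   -- 11    T[I + k]
  jeq (# 8) (# 9) (# 13) (# 14) ∷     -- 12    if they differ, next candidate
  add (# 10) (# 2) (# 10) (# 7) ∷     -- 13    k ← k + 1
  add (# 6) (# 2) (# 6) (# 3) ∷       -- 14  next candidate: P′ ← P′ + 1
  add (# 3) (# 1) (# 6) (# 16) ∷      -- 15  I ← P′
  add (# 4) (# 2) (# 4) (# 1) ∷       -- 16  J ← J + 1
  halt true ∷                         -- 17
  halt false ∷ []                     -- 18

module Correctness (σ n : ℕ) (T : Vec (Fin σ) n) (P : List (Fin σ)) where

  text : List (Fin σ)
  text = toList T

  m : ℕ
  m = length P

  -- Every register holds n, a sum of two numbers ≤ n, or a character.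
  Bd : ℕ
  Bd = suc (n + n + σ)

  open Run program T Bd

  ≤n⇒≤Bd : ∀ {v} → v ≤ n → v ≤ Bd
  ≤n⇒≤Bd v≤n = ≤-trans v≤n (≤-trans (m≤m+n n n) (≤-trans (m≤m+n (n + n) σ) (n≤1+n _)))

  +≤Bd : ∀ {u v} → u ≤ n → v ≤ n → u + v ≤ Bd
  +≤Bd u≤n v≤n = ≤-trans (+-mono-≤ u≤n v≤n) (≤-trans (m≤m+n (n + n) σ) (n≤1+n _))

  char≤Bd : (c : Fin σ) → toℕ c ≤ Bd
  char≤Bd c = ≤-trans (<⇒≤ (toℕ<n c)) (≤-trans (m≤n+m σ (n + n)) (n≤1+n _))

  inText : ∀ {i c} → lookup? text i ≡ just c → i < n
  inText {i} hit = subst (i <_) (length-toList T) (lookup?≡just⇒< text hit)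

  -- Registers 7–10, whose contents are arbitrary at the heads of the loops.
  record Scratch : Set where
    field
      q a b k : ℕ
      q≤Bd : q ≤ Bd
      a≤Bd : a ≤ Bd
      b≤Bd : b ≤ Bd
      k≤Bd : k ≤ Bd

  regs : (I J x P′ : ℕ) → Scratch → Vec ℕ 11
  regs I J x P′ w =
    n ∷ 0 ∷ 1 ∷ I ∷ J ∷ x ∷ P′ ∷ Scratch.q w ∷ Scratch.a w ∷ Scratch.b w ∷ Scratch.k w ∷ []

  at : Fin 19 → (I J x P′ : ℕ) → Scratch → List (Fin σ) → Conf σ 11 18
  at pc I J x P′ w s = conf pc (regs I J x P′ w) s

  regs-bounded : ∀ {I J x P′} → I ≤ n → J ≤ n → x ≤ Bd → P′ ≤ n → (w : Scratch) →
                 All (_≤ Bd) (regs I J x P′ w)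
  regs-bounded I≤n J≤n x≤Bd P′≤n w =
    ≤n⇒≤Bd ≤-refl ∷ z≤n ∷ s≤s z≤n ∷ ≤n⇒≤Bd I≤n ∷ ≤n⇒≤Bd J≤n ∷ x≤Bd ∷ ≤n⇒≤Bd P′≤n ∷
    Scratch.q≤Bd w ∷ Scratch.a≤Bd w ∷ Scratch.b≤Bd w ∷ Scratch.k≤Bd w ∷ []

  Decides : Conf σ 11 18 → ℕ → Set
  Decides c t = Σ Bool λ b → Exec program T Bd c t b × (b ≡ true ⇔ Occurs P text)

  Decides-mono : ∀ {c t t′} → t ≤ t′ → Decides c t → Decides c t′
  Decides-mono t≤t′ (b , exec , correct) = b , Exec-mono-steps t≤t′ exec , correct

  Steps-Decides : ∀ {c c′ t u} → Steps c t c′ → Decides c′ u → Decides c (t + u)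
  Steps-Decides run (b , exec , correct) = b , Steps-Exec run exec , correct

  Decides-halt : ∀ {pc R s t b} → All (_≤ Bd) R → lookup program pc ≡ halt b →
                 (b ≡ true ⇔ Occurs P text) → Decides (conf pc R s) t
  Decides-halt bnd halts correct = _ , done bnd halts , correct

  accept : Occurs P text → (true ≡ true ⇔ Occurs P text)
  accept occ = mk⇔ (λ _ → occ) (λ _ → refl)

  reject : ¬ Occurs P text → (false ≡ true ⇔ Occurs P text)
  reject absent = mk⇔ (λ ()) (λ occ → ⊥-elim (absent occ))

  -- The time granted at a candidate is cost d (1 + r), and at line 1 it is 2 + cost d r, where
  -- d candidates are left and r characters of P are unread: a rejected candidate takes at most
  -- 7m steps and an accepted character at most 7(n + 1).
  cost : ℕ → ℕ → ℕ
  cost d r = d * (m * 7) + r * (suc n * 7)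

  cost-suc-d : ∀ d r → cost (suc d) r ≡ m * 7 + cost d r
  cost-suc-d d r = +-assoc (m * 7) (d * (m * 7)) (r * (suc n * 7))

  cost-suc-r : ∀ d r → cost d (suc r) ≡ suc n * 7 + cost d r
  cost-suc-r d r = x∙yz≈y∙xz (d * (m * 7)) (suc n * 7) (r * (suc n * 7))

  halting-fits : ∀ d r → 2 ≤ cost d (suc r)
  halting-fits d r =
    ≤-trans (m≤m+n 2 (5 + n * 7)) (≤-trans (m≤m+n (suc n * 7) (r * (suc n * 7))) (m≤n+m _ (d * (m * 7))))

  rejection-fits : ∀ {J u} d r → suc J ≤ m → u ≤ 4 + J * 7 → u + suc (cost d r) ≤ cost (suc d) r
  rejection-fits {J} {u} d r J<m u≤ = begin
    u + suc (cost d r)    ≡⟨ +-suc u (cost d r) ⟩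
    suc u + cost d r      ≤⟨ +-monoˡ-≤ (cost d r) (≤-trans (s≤s u≤) (+-monoˡ-≤ (J * 7) (m≤m+n 5 2))) ⟩
    suc J * 7 + cost d r  ≤⟨ +-monoˡ-≤ (cost d r) (*-monoˡ-≤ 7 J<m) ⟩
    m * 7 + cost d r      ≡⟨ cost-suc-d d r ⟨
    cost (suc d) r        ∎
    where open ≤-Reasoning

  acceptance-fits : ∀ {J u} d r → suc J ≤ n → u ≤ 7 + J * 7 → u + (2 + cost d r) ≤ cost d (suc r)
  acceptance-fits {J} {u} d r J<n u≤ = begin
    u + (2 + cost d r)      ≤⟨ +-mono-≤ (≤-trans u≤ (*-monoˡ-≤ 7 J<n))
                                         (+-monoˡ-≤ (cost d r) (m≤m+n 2 5)) ⟩
    n * 7 + (7 + cost d r)  ≡⟨ x∙yz≈y∙xz (n * 7) 7 (cost d r) ⟩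
    suc n * 7 + cost d r    ≡⟨ cost-suc-r d r ⟨
    cost d (suc r)          ∎
    where open ≤-Reasoning

  DecidesAtRead : List (Fin σ) → Set
  DecidesAtRead s = ∀ pre I d x (w : Scratch) → P ≡ pre ++ s → I + d ≡ n → I + length pre ≤ n → x ≤ Bd →
                    OccursAt pre text I → ¬ OccursBefore pre text I →
                    Decides (at (# 1) I (length pre) x I w s) (2 + cost d (length s))

  -- Taking the read loop on the shorter rest s as a parameter avoids a mutual recursion.
  module Candidates (pre : List (Fin σ)) (x : Fin σ) (s : List (Fin σ)) (I : ℕ)
                    (P≡ : P ≡ pre ++ x ∷ s) (I+J≤n : I + length pre ≤ n) (occ : OccursAt pre text I)
                    (decidesAtRead : DecidesAtRead s) where

    J r : ℕ
    J = length pre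
    r = length s

    I≤n : I ≤ n
    I≤n = ≤-trans (m≤m+n I J) I+J≤n

    J≤n : J ≤ n
    J≤n = ≤-trans (m≤n+m J I) I+J≤n

    J<m : suc J ≤ m
    J<m = subst (suc J ≤_) (sym (trans (cong length P≡) (length-++ pre))) (m<m+n J z<s)

    P≡′ : P ≡ (pre ∷ʳ x) ++ s
    P≡′ = trans P≡ (sym (∷ʳ-++ pre x s))

    I+K<n : ∀ {K} → K < J → I + K < n
    I+K<n K<J = inText (trans (agrees occ _ K<J) (proj₂ (<⇒lookup?≡just pre K<J)))

    module Comparison (P′ : ℕ) (P′≤n : P′ ≤ n) where

      state : Fin 19 → Scratch → Conf σ 11 18
      state pc w = at pc I J (toℕ x) P′ w s

      bounded : (w : Scratch) → All (_≤ Bd) (regs I J (toℕ x) P′ w)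
      bounded = regs-bounded I≤n J≤n (char≤Bd x) P′≤n

      Agree : ℕ → Set
      Agree K = ∀ i → i < K → lookup? text (P′ + i) ≡ lookup? text (I + i)

      agree⇒occursAt : Agree J → OccursAt pre text P′
      agree⇒occursAt agree = occursAt λ i i<J → trans (agree i i<J) (agrees occ i i<J)

      agree-suc : ∀ {K} → Agree K → lookup? text (P′ + K) ≡ lookup? text (I + K) → Agree (suc K)
      agree-suc agree agreeK i i<1+K with m<1+n⇒m<n∨m≡n i<1+K
      ... | inj₁ i<K  = agree i i<K
      ... | inj₂ refl = agreeK

      ¬occursAt-beyond : ∀ {K} → K < J → ¬ P′ + K < n → ¬ OccursAt pre text P′
      ¬occursAt-beyond K<J outside found =
        outside (inText (trans (agrees found _ K<J) (proj₂ (<⇒lookup?≡just pre K<J))))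

      ¬occursAt-mismatch : ∀ {K} → K < J → lookup? text (P′ + K) ≢ lookup? text (I + K) → ¬ OccursAt pre text P′
      ¬occursAt-mismatch K<J differ found = differ (trans (agrees found _ K<J) (sym (agrees occ _ K<J)))

      data Exit (w : Scratch) (e : ℕ) : Set where
        matched    : OccursAt pre text P′ → (w′ : Scratch) →
                     Steps (state (# 7) w) (suc (e * 7)) (state (# 15) w′) → Exit w e
        mismatched : ¬ OccursAt pre text P′ → (w′ : Scratch) → ∀ {u} → u ≤ e * 7 →
                     Steps (state (# 7) w) u (state (# 14) w′) → Exit w e

      Exit-prepend : ∀ {w w′ e} → Steps (state (# 7) w) 7 (state (# 7) w′) → Exit w′ e → Exit w (suc e)
      Exit-prepend iteration (matched found w″ run)       = matched found w″ (iteration ++ˢ run)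
      Exit-prepend iteration (mismatched absent w″ u≤ run) =
        mismatched absent w″ (+-monoʳ-≤ 7 u≤) (iteration ++ˢ run)

      compare : ∀ e (w : Scratch) → Scratch.k w + e ≡ J → Agree (Scratch.k w) → Exit w e
      compare zero w K+0≡J agree =
        matched (agree⇒occursAt (subst Agree K≡J agree)) w (tick-jlt-no (bounded w) refl (<-irrefl K≡J) [])
        where
        K≡J : Scratch.k w ≡ J
        K≡J = trans (sym (+-identityʳ _)) K+0≡J
      compare (suc e) w K+e≡J agree = readCandidate (P′ + K <? n)
        where
        K : ℕ
        K = Scratch.k w

        K<J : K < J
        K<J = subst (K <_) K+e≡J (m<m+n K z<s)

        K≤n : K ≤ n
        K≤n = ≤-trans (<⇒≤ K<J) J≤n

        w₁ : Scratch
        w₁ = record w { q = P′ + K ; q≤Bd = +≤Bd P′≤n K≤n }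

        toP′+K : Steps (state (# 7) w) 2 (state (# 9) w₁)
        toP′+K = tick-jlt-yes (bounded w) refl K<J (tick (bounded w) refl [])

        readCandidate : Dec (P′ + K < n) → Exit w (suc e)
        readCandidate (no outside) =
          mismatched (¬occursAt-beyond K<J outside) w₁ (m≤m+n 3 (4 + e * 7))
            (toP′+K ++ˢ tick-query-out (bounded w₁) refl outside [])
        readCandidate (yes inside) = compareChars (c₁ Fin.≟ c₂)
          where
          c₁ c₂ : Fin σ
          c₁ = lookup T (fromℕ< inside)
          c₂ = lookup T (fromℕ< (I+K<n K<J))

          w₂ w₃ w₄ : Scratch
          w₂ = record w₁ { a = toℕ c₁ ; a≤Bd = char≤Bd c₁ }
          w₃ = record w₂ { q = I + K ; q≤Bd = +≤Bd I≤n K≤n }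
          w₄ = record w₃ { b = toℕ c₂ ; b≤Bd = char≤Bd c₂ }

          toComparison : Steps (state (# 7) w) 5 (state (# 12) w₄)
          toComparison =
            toP′+K ++ˢ tick-query-in (bounded w₁) refl inside
                         (tick (bounded w₂) refl (tick-query-in (bounded w₃) refl (I+K<n K<J) []))

          chars≡⇒texts≡ : c₁ ≡ c₂ → lookup? text (P′ + K) ≡ lookup? text (I + K)
          chars≡⇒texts≡ c₁≡c₂ =
            trans (lookup?-toList T inside) (trans (cong just c₁≡c₂) (sym (lookup?-toList T (I+K<n K<J))))

          texts≡⇒chars≡ : lookup? text (P′ + K) ≡ lookup? text (I + K) → c₁ ≡ c₂
          texts≡⇒chars≡ eq =
            just-injective (trans (sym (lookup?-toList T inside)) (trans eq (lookup?-toList T (I+K<n K<J))))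

          compareChars : Dec (c₁ ≡ c₂) → Exit w (suc e)
          compareChars (no c₁≢c₂) =
            mismatched (¬occursAt-mismatch K<J (c₁≢c₂ ∘ texts≡⇒chars≡)) w₄ (m≤m+n 6 (1 + e * 7))
              (toComparison ++ˢ tick-jeq-no (bounded w₄) refl (c₁≢c₂ ∘ toℕ-injective) [])
          compareChars (yes c₁≡c₂) =
            Exit-prepend {w′ = w₅}
              (toComparison ++ˢ tick-jeq-yes (bounded w₄) refl (cong toℕ c₁≡c₂) (tick (bounded w₄) refl []))
              (compare e w₅ (trans (sym (+-suc K e)) K+e≡J) (agree-suc agree (chars≡⇒texts≡ c₁≡c₂)))
            where
            w₅ : Scratch
            w₅ = record w₄ { k = suc K ; k≤Bd = ≤n⇒≤Bd (≤-trans K<J J≤n) }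

    decidesBeyondText : ∀ d P′ (P′≤n : P′ ≤ n) (w : Scratch) → ¬ OccursBefore (pre ∷ʳ x) text P′ →
                        ¬ P′ + J < n → Decides (at (# 3) I J (toℕ x) P′ w s) (cost d (suc r))
    decidesBeyondText d P′ P′≤n w before outside =
      Decides-mono (halting-fits d r)
        (Steps-Decides (tick (bounded w) refl (tick-query-out (bounded w₁) refl outside []))
                       (Decides-halt (bounded w₁) refl (reject absent)))
      where
      open Comparison P′ P′≤n using (bounded)

      w₁ : Scratch
      w₁ = record w { q = P′ + J ; q≤Bd = +≤Bd P′≤n J≤n }

      absent : ¬ Occurs P text
      absent = subst (λ p → ¬ Occurs p text) (sym P≡′)
                 (¬occurs-beyond pre x s before (subst (_≤ P′ + J) (sym (length-toList T)) (≮⇒≥ outside)))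

    rejected : ∀ d {P′ u} → P′ ≤ n → (w w′ : Scratch) → u ≤ 4 + J * 7 →
               Steps (at (# 3) I J (toℕ x) P′ w s) u (at (# 14) I J (toℕ x) P′ w′ s) →
               Decides (at (# 3) I J (toℕ x) (suc P′) w′ s) (cost d (suc r)) →
               Decides (at (# 3) I J (toℕ x) P′ w s) (cost (suc d) (suc r))
    rejected d {P′} P′≤n w w′ u≤ run onward =
      Decides-mono (rejection-fits d (suc r) J<m u≤) (Steps-Decides run (Steps-Decides (tick (bounded w′) refl []) onward))
      where open Comparison P′ P′≤n using (bounded)

    accepted : ∀ {d P′ u} (w w′ : Scratch) → P′ + d ≡ n → P′ + J < n →
               OccursAt (pre ∷ʳ x) text P′ → ¬ OccursBefore (pre ∷ʳ x) text P′ → u ≤ 7 + J * 7 →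
               Steps (at (# 3) I J (toℕ x) P′ w s) u (at (# 1) P′ (suc J) (toℕ x) P′ w′ s) →
               Decides (at (# 3) I J (toℕ x) P′ w s) (cost d (suc r))
    accepted {d} {P′} w w′ P′+d≡n inside found before u≤ run =
      Decides-mono (acceptance-fits d r (≤-<-trans (m≤n+m J P′) inside) u≤) (Steps-Decides run extended)
      where
      fits : P′ + length (pre ∷ʳ x) ≤ n
      fits = subst (λ j → P′ + j ≤ n) (sym (length-∷ʳ pre x)) (subst (_≤ n) (sym (+-suc P′ J)) inside)

      extended : Decides (at (# 1) P′ (suc J) (toℕ x) P′ w′ s) (2 + cost d r)
      extended = subst (λ j → Decides (at (# 1) P′ j (toℕ x) P′ w′ s) (2 + cost d r)) (length-∷ʳ pre x)
                   (decidesAtRead (pre ∷ʳ x) P′ d (toℕ x) w′ P≡′ P′+d≡n fits (char≤Bd x) found before)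

    decidesAtCandidate : ∀ d P′ → P′ + d ≡ n → (w : Scratch) → ¬ OccursBefore (pre ∷ʳ x) text P′ →
                         Decides (at (# 3) I J (toℕ x) P′ w s) (cost d (suc r))
    decidesAtCandidate zero P′ P′+0≡n w before = decidesBeyondText zero P′ P′≤n w before outside
      where
      P′≤n : P′ ≤ n
      P′≤n = ≤-reflexive (trans (sym (+-identityʳ P′)) P′+0≡n)

      outside : ¬ P′ + J < n
      outside inside = <⇒≱ inside (≤-trans (≤-reflexive (sym P′+0≡n)) (+-monoʳ-≤ P′ z≤n))
    decidesAtCandidate (suc d) P′ P′+d≡n w before = probe (P′ + J <? n)
      where
      P′≤n : P′ ≤ n
      P′≤n = ≤-trans (m≤m+n P′ (suc d)) (≤-reflexive P′+d≡n)

      open Comparison P′ P′≤n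

      nextCandidate : (w′ : Scratch) → ¬ OccursAt (pre ∷ʳ x) text P′ →
             Decides (at (# 3) I J (toℕ x) (suc P′) w′ s) (cost d (suc r))
      nextCandidate w′ absent =
        decidesAtCandidate d (suc P′) (trans (sym (+-suc P′ d)) P′+d≡n) w′ (¬occursBefore-suc before absent)

      probe : Dec (P′ + J < n) → Decides (state (# 3) w) (cost (suc d) (suc r))
      probe (no outside) = decidesBeyondText (suc d) P′ P′≤n w before outside
      probe (yes inside) = checkFirst (c Fin.≟ x)
        where
        c : Fin σ
        c = lookup T (fromℕ< inside)

        w₁ w₂ w₃ : Scratch
        w₁ = record w { q = P′ + J ; q≤Bd = +≤Bd P′≤n J≤n }
        w₂ = record w₁ { a = toℕ c ; a≤Bd = char≤Bd c }
        w₃ = record w₂ { k = 0 ; k≤Bd = z≤n }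

        checkFirst : Dec (c ≡ x) → Decides (state (# 3) w) (cost (suc d) (suc r))
        checkFirst (no c≢x) =
          rejected d P′≤n w w₂ (m≤m+n 3 (1 + J * 7))
            (tick (bounded w) refl (tick-query-in (bounded w₁) refl inside
              (tick-jeq-no (bounded w₂) refl (c≢x ∘ toℕ-injective) [])))
            (nextCandidate w₂ absent)
          where
          absent : ¬ OccursAt (pre ∷ʳ x) text P′
          absent found = c≢x (just-injective (trans (sym (lookup?-toList T inside)) (occursAt-∷ʳ⁻ pre x found)))
        checkFirst (yes c≡x) = afterComparison (compare J w₃ refl (λ _ ()))
          where
          toLoop : Steps (state (# 3) w) 4 (state (# 7) w₃)
          toLoop = tick (bounded w) refl (tick-query-in (bounded w₁) refl inside
                     (tick-jeq-yes (bounded w₂) refl (cong toℕ c≡x) (tick (bounded w₂) refl [])))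

          afterComparison : Exit w₃ J → Decides (state (# 3) w) (cost (suc d) (suc r))
          afterComparison (mismatched absent w′ u≤ run) =
            rejected d P′≤n w w′ (+-monoʳ-≤ 4 u≤) (toLoop ++ˢ run) (nextCandidate w′ (absent ∘ occursAt-++⁻ˡ pre [ x ]))
          afterComparison (matched found w′ run) =
            accepted w w′ P′+d≡n inside
              (occursAt-∷ʳ pre x found (trans (lookup?-toList T inside) (cong just c≡x))) before
              (≤-reflexive (cong (5 +_) (+-comm (J * 7) 2)))
              (toLoop ++ˢ run ++ˢ tick (bounded w′) refl (tick (regs-bounded P′≤n J≤n (char≤Bd x) P′≤n w′) refl []))

  decidesAtRead : ∀ s → DecidesAtRead s
  decidesAtRead [] pre I d x w P≡ I+d≡n I+J≤n x≤Bd occ before =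
    Steps-Decides (tick bounded refl []) (Decides-halt bounded refl (accept present))
    where
    I≤n : I ≤ n
    I≤n = ≤-trans (m≤m+n I _) I+J≤n

    bounded : All (_≤ Bd) (regs I (length pre) x I w)
    bounded = regs-bounded I≤n (≤-trans (m≤n+m _ I) I+J≤n) x≤Bd I≤n w

    present : Occurs P text
    present = occursAt⇒occurs P text I (subst (λ p → OccursAt p text I) (sym (trans P≡ (++-identityʳ pre))) occ)
  decidesAtRead (y ∷ s) pre I d x w P≡ I+d≡n I+J≤n x≤Bd occ before =
    Steps-Decides (tick (regs-bounded I≤n J≤n x≤Bd I≤n w) refl
                    (tick (regs-bounded I≤n J≤n (char≤Bd y) I≤n w) refl []))
      (decidesAtCandidate d I I+d≡n w (¬occursBefore-++ pre [ y ] before))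
    where
    open Candidates pre y s I P≡ I+J≤n occ (decidesAtRead s)

  decides : Decides (init 11 n P) (3 + cost n m)
  decides = Steps-Decides (tick initial refl [])
              (decidesAtRead P [] 0 n 0 empty refl refl z≤n z≤n (occursAt λ _ ()) λ { (_ , () , _) })
    where
    initial : All (_≤ Bd) (initRegs 11 n)
    initial = ≤n⇒≤Bd ≤-refl ∷ z≤n ∷ z≤n ∷ z≤n ∷ z≤n ∷ z≤n ∷ z≤n ∷ z≤n ∷ z≤n ∷ z≤n ∷ z≤n ∷ []

    empty : Scratch
    empty = record { q = 0 ; a = 0 ; b = 0 ; k = 0 ; q≤Bd = z≤n ; a≤Bd = z≤n ; b≤Bd = z≤n ; k≤Bd = z≤n }

running-time-bound : ∀ σ n m → 3 + (n * (m * 7) + m * (suc n * 7)) ≤ (14 + σ) * (suc n * suc m)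
running-time-bound σ n m =
  ≤-trans (m≤m+n _ (n * 14 + m * 7 + 11))
    (≤-trans (≤-reflexive (sym (expand n m))) (*-monoˡ-≤ (suc n * suc m) (m≤m+n 14 σ)))
  where
  expand : ∀ n m → 14 * (suc n * suc m) ≡ 3 + (n * (m * 7) + m * (suc n * 7)) + (n * 14 + m * 7 + 11)
  expand = solve-∀

word-size-bound : ∀ σ n → suc (n + n + σ) ≤ (14 + σ) * suc n ^ (14 + σ)
word-size-bound σ n =
  ≤-trans (m≤m+n _ (n * 12 + σ * n + 13))
    (≤-trans (≤-reflexive (sym (expand σ n)))
      (*-monoʳ-≤ (14 + σ) (m≤m*n (suc n) (suc n ^ (13 + σ)) {{m^n≢0 (suc n) (13 + σ)}})))
  where
  expand : ∀ σ n → (14 + σ) * suc n ≡ suc (n + n + σ) + (n * 12 + σ * n + 13)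
  expand = solve-∀

corollary1 : (σ : ℕ) → Σ ℕ λ k → Σ ℕ λ L → Σ (Program k L) λ prog →
               Σ ℕ λ c → SolvesInTime {σ} prog c
corollary1 σ = 11 , 18 , program , 14 + σ , solves
  where
  solves : SolvesInTime {σ} program (14 + σ)
  solves n T P =
    let b , exec , correct = Correctness.decides σ n T P
    in b , Exec-mono-bound (word-size-bound σ n) (Exec-mono-steps (running-time-bound σ n (length P)) exec) , correct
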